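{- Let $\mathbf{u}$ be an eventually periodic infinite binary word whose set of factors contains infinitely many palindromes and infinitely many antipalindromes. Then there exist a word $b\in\{0,1\}^*$ and a palindrome $c\in\{0,1\}^*$ such that $\mathbf{u}=b\big(c\,\mathrm{E}(c)\big)^{\infty}$.
   Context: $\mathrm{R}(w_1\cdots w_n)=w_n\cdots w_1$, palindrome: $\mathrm{R}(w)=w$. $\mathrm{E}(w_1\cdots w_n)=(1-w_n)\cdots(1-w_1)$, antipalindrome: $\mathrm{E}(w)=w$. An infinite word is eventually periodic if it equals $vw^\infty$ for words $v,w$ with $w$ nonempty, where $w^\infty$ is the infinite repetition of $w$. -}

module Defs where

open import Data.Bool using (Bool; true; false; not)
open import Data.Nat using (ℕ; zero; suc; _+_; _∸_; _<ᵇ_)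
open import Data.Nat.DivMod using (_%_)
open import Data.List using (List; []; _∷_; _++_; reverse; map; length)
open import Data.List.Membership.Propositional using (_∉_)
open import Data.Product using (Σ; ∃; _×_; _,_)
open import Relation.Binary.PropositionalEquality using (_≡_; _≢_)

Word : Set
Word = List Bool

InfWord : Set
InfWord = ℕ → Bool

R : Word → Word
R = reverse

E : Word → Word
E w = reverse (map not w)

IsPalindrome : Word → Set
IsPalindrome w = R w ≡ w

IsAntipalindrome : Word → Set
IsAntipalindrome w = E w ≡ w

factorAt : InfWord → ℕ → ℕ → Word
factorAt u i zero    = []
factorAt u i (suc n) = u i ∷ factorAt u (suc i) n

IsFactor : Word → InfWord → Set
IsFactor w u = ∃ λ i → factorAt u i (length w) ≡ w

-- total lookup with default (only used on in-range indices below)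
at : Word → ℕ → Bool
at []      _       = false
at (x ∷ _) zero    = x
at (_ ∷ w) (suc n) = at w n

-- the infinite word v w w w ... (w must be nonempty; see EqPeriodic)
periodicWord : Word → (w : Word) → InfWord
periodicWord v [] n = at v n
periodicWord v w@(_ ∷ _) n with n <ᵇ length v
... | true  = at v n
... | false = at w ((n ∸ length v) % length w)

EqPeriodic : InfWord → Word → Word → Set
EqPeriodic u v w = (w ≢ []) × (∀ n → u n ≡ periodicWord v w n)

EventuallyPeriodic : InfWord → Set
EventuallyPeriodic u = Σ Word λ v → Σ Word λ w → EqPeriodic u v w

-- a predicate on words holds for infinitely many factors of u:
-- no finite list of words exhausts them
InfinitelyManyFactors : (Word → Set) → InfWord → Set
InfinitelyManyFactors P u =
  (L : List Word) → Σ Word λ w → IsFactor w u × P w × w ∉ L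

module Submission where

-- Write u = v w^∞, N = |v|, p = |w|, and let y(m) = u(N + m) be
-- the p-periodic tail of u.  A palindromic factor of u of length at least
-- 2N + p contains, after its first N letters, a full period of y mirrored
-- onto another full period; by periodicity y then has a reflection
-- y(a) = y(b) whenever a + b ≡ S (mod p).  Likewise a long antipalindromic
-- factor gives an antireflection y(a) = not y(b) whenever a + b ≡ T (mod p).
-- Composing the two reflections gives a translation: y(m + D) = not y(m)
-- for some D ≥ 1, so y is 2D-periodic and the reflection holds for exact
-- sums a + b = S + 2D.  Its centre cannot be a letter (that letter would
-- equal its own negation), so it lies between two letters, and the block
-- c = y(q) … y(q + D - 1) starting there is a palindrome.  Antiperiodicity
-- makes the next D letters equal to E(c), hence u = b (c E(c))^∞ with b the
-- prefix u(0) … u(N + q - 1).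

open import Defs
open import Data.List using (_++_)
open import Data.Product using (Σ; _×_)

open import Data.Bool using (Bool; true; false; not; T)
open import Data.Bool.Properties using (not-involutive; not-¬)
open import Data.Empty using (⊥-elim)
open import Data.List using (List; []; _∷_; [_]; reverse; map; length)
open import Data.List.Properties using (length-map; length-reverse; unfold-reverse)
open import Data.List.Membership.Propositional using (_∈_)
open import Data.List.Membership.Propositional.Properties using (∈-++⁺ˡ; ∈-++⁺ʳ; ∈-map⁺)
open import Data.List.Relation.Unary.Any using (here)
open import Data.Nat using (ℕ; zero; suc; _+_; _*_; _∸_; _<_; _≤_; _<ᵇ_; _<?_; z≤n; s≤s; s≤s⁻¹)
open import Data.Nat.Properties
open import Data.Nat.DivMod using (_%_; _/_; m≡m%n+[m/n]*n; m%n<n; m%n%n≡m%n; [m+n]%n≡m%n; [m+kn]%n≡m%n; %-distribˡ-+)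
open import Data.Nat.Tactic.RingSolver using (solve-∀)
open import Data.Product using (∃; _,_)
open import Data.Sum using (_⊎_; inj₁; inj₂)
open import Function using (id)
open import Relation.Binary.PropositionalEquality using (_≡_; refl; sym; trans; cong; cong₂; subst; module ≡-Reasoning)
open import Relation.Nullary using (¬_; yes; no)

at-factor : ∀ (z : InfWord) n {L} x → x < L → at (factorAt z n L) x ≡ z (n + x)
at-factor z n {suc L} zero    _          = cong z (sym (+-identityʳ n))
at-factor z n {suc L} (suc x) (s≤s x<L) =
  trans (at-factor z (suc n) x x<L) (cong z (sym (+-suc n x)))

length-factor : ∀ (z : InfWord) n L → length (factorAt z n L) ≡ L
length-factor z n zero    = refl
length-factor z n (suc L) = cong suc (length-factor z (suc n) L)

factor-ext : ∀ (z : InfWord) n (w : Word) {L} → length w ≡ L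
           → (∀ x → x < L → at w x ≡ z (n + x)) → w ≡ factorAt z n L
factor-ext z n []      refl _ = refl
factor-ext z n (a ∷ w) refl h =
  cong₂ _∷_ (trans (h 0 (s≤s z≤n)) (cong z (+-identityʳ n)))
            (factor-ext z (suc n) w refl λ x x<L →
               trans (h (suc x) (s≤s x<L)) (cong z (+-suc n x)))

factorAt-++ : ∀ (z : InfWord) n m k
            → factorAt z n (m + k) ≡ factorAt z n m ++ factorAt z (n + m) k
factorAt-++ z n zero    k = cong (λ i → factorAt z i k) (sym (+-identityʳ n))
factorAt-++ z n (suc m) k = cong (z n ∷_) (begin
  factorAt z (suc n) (m + k)                            ≡⟨ factorAt-++ z (suc n) m k ⟩
  factorAt z (suc n) m ++ factorAt z (suc n + m) k      ≡⟨ cong (λ i → factorAt z (suc n) m ++ factorAt z i k) (sym (+-suc n m)) ⟩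
  factorAt z (suc n) m ++ factorAt z (n + suc m) k      ∎)
  where open ≡-Reasoning

at-++ˡ : ∀ (xs ys : Word) x → x < length xs → at (xs ++ ys) x ≡ at xs x
at-++ˡ (a ∷ xs) ys zero    _         = refl
at-++ˡ (a ∷ xs) ys (suc x) (s≤s x<) = at-++ˡ xs ys x x<

at-++ʳ : ∀ (xs ys : Word) k → at (xs ++ ys) (length xs + k) ≡ at ys k
at-++ʳ []       ys k = refl
at-++ʳ (a ∷ xs) ys k = at-++ʳ xs ys k

at-map-not : ∀ (w : Word) x → x < length w → at (map not w) x ≡ not (at w x)
at-map-not (a ∷ w) zero    _         = refl
at-map-not (a ∷ w) (suc x) (s≤s x<) = at-map-not w x x<

-- Positions x and x′ are mirror images in a block of length L when
-- x + x′ + 1 = L; both then lie in the block, and every x < L has a mirror.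
mirror<ˡ : ∀ {x x′ L} → suc (x + x′) ≡ L → x < L
mirror<ˡ {x} {x′} refl = s≤s (m≤m+n x x′)

mirror<ʳ : ∀ {x x′ L} → suc (x + x′) ≡ L → x′ < L
mirror<ʳ {x} {x′} refl = s≤s (m≤n+m x′ x)

mirror-exists : ∀ {x L} → x < L → ∃ λ x′ → suc (x + x′) ≡ L
mirror-exists {x} {L} x<L = L ∸ suc x , m+[n∸m]≡n x<L

at-reverse : ∀ (w : Word) x x′ → suc (x + x′) ≡ length w → at (reverse w) x ≡ at w x′
at-reverse (a ∷ w) x zero e = begin
  at (reverse (a ∷ w)) x            ≡⟨ cong (λ v → at v x) (unfold-reverse a w) ⟩
  at (reverse w ++ [ a ]) x         ≡⟨ cong (at (reverse w ++ [ a ])) x≡end ⟩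
  at (reverse w ++ [ a ]) (length (reverse w) + 0) ≡⟨ at-++ʳ (reverse w) [ a ] 0 ⟩
  a                                 ∎
  where
  open ≡-Reasoning
  x≡end : x ≡ length (reverse w) + 0
  x≡end = trans (sym (+-identityʳ x))
                (trans (suc-injective e) (sym (trans (+-identityʳ _) (length-reverse w))))
at-reverse (a ∷ w) x (suc x′) e = begin
  at (reverse (a ∷ w)) x            ≡⟨ cong (λ v → at v x) (unfold-reverse a w) ⟩
  at (reverse w ++ [ a ]) x         ≡⟨ at-++ˡ (reverse w) [ a ] x (subst (x <_) (sym (length-reverse w)) (mirror<ˡ e′)) ⟩
  at (reverse w) x                  ≡⟨ at-reverse w x x′ e′ ⟩
  at w x′                            ∎
  where
  open ≡-Reasoning
  e′ : suc (x + x′) ≡ length w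
  e′ = suc-injective (trans (cong suc (sym (+-suc x x′))) e)

at-E : ∀ (w : Word) x x′ → suc (x + x′) ≡ length w → at (E w) x ≡ not (at w x′)
at-E w x x′ e = begin
  at (reverse (map not w)) x  ≡⟨ at-reverse (map not w) x x′ (trans e (sym (length-map not w))) ⟩
  at (map not w) x′            ≡⟨ at-map-not w x′ (mirror<ʳ e) ⟩
  not (at w x′)                ∎
  where open ≡-Reasoning

Symmetric : (Bool → Bool) → Word → Set
Symmetric f w = ∀ x x′ → suc (x + x′) ≡ length w → at w x ≡ f (at w x′)

palindrome-symmetric : ∀ {w} → IsPalindrome w → Symmetric id w
palindrome-symmetric {w} pal x x′ e = trans (cong (λ v → at v x) (sym pal)) (at-reverse w x x′ e)

antipalindrome-symmetric : ∀ {w} → IsAntipalindrome w → Symmetric not w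
antipalindrome-symmetric {w} anti x x′ e = trans (cong (λ v → at v x) (sym anti)) (at-E w x x′ e)

symmetric-occurrence : ∀ {w} f (u : InfWord) i → factorAt u i (length w) ≡ w → Symmetric f w
                     → ∀ x x′ → suc (x + x′) ≡ length w → u (i + x) ≡ f (u (i + x′))
symmetric-occurrence {w} f u i occ sym-w x x′ e = begin
  u (i + x)                          ≡⟨ sym (at-factor u i x (mirror<ˡ e)) ⟩
  at (factorAt u i (length w)) x     ≡⟨ cong (λ v → at v x) occ ⟩
  at w x                             ≡⟨ sym-w x x′ e ⟩
  f (at w x′)                         ≡⟨ cong (λ v → f (at v x′)) (sym occ) ⟩
  f (at (factorAt u i (length w)) x′) ≡⟨ cong f (at-factor u i x′ (mirror<ʳ e)) ⟩
  f (u (i + x′))                      ∎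
  where open ≡-Reasoning

wordsOfLength : ℕ → List Word
wordsOfLength zero    = [ [] ]
wordsOfLength (suc n) = map (true ∷_) (wordsOfLength n) ++ map (false ∷_) (wordsOfLength n)

wordsShorterThan : ℕ → List Word
wordsShorterThan zero    = []
wordsShorterThan (suc K) = wordsOfLength K ++ wordsShorterThan K

∈-wordsOfLength : ∀ (w : Word) → w ∈ wordsOfLength (length w)
∈-wordsOfLength []          = here refl
∈-wordsOfLength (true ∷ w)  = ∈-++⁺ˡ (∈-map⁺ (true ∷_) (∈-wordsOfLength w))
∈-wordsOfLength (false ∷ w) =
  ∈-++⁺ʳ (map (true ∷_) (wordsOfLength (length w))) (∈-map⁺ (false ∷_) (∈-wordsOfLength w))

∈-wordsShorterThan : ∀ K (w : Word) → length w < K → w ∈ wordsShorterThan K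
∈-wordsShorterThan (suc K) w (s≤s |w|≤K) with m≤n⇒m<n∨m≡n |w|≤K
... | inj₁ |w|<K = ∈-++⁺ʳ (wordsOfLength K) (∈-wordsShorterThan K w |w|<K)
... | inj₂ refl  = ∈-++⁺ˡ (∈-wordsOfLength w)

-- Infinitely many factors with a property include arbitrarily long ones,
-- since only finitely many words are shorter than K.
long-factor : ∀ {P u} → InfinitelyManyFactors P u → ∀ K
            → Σ Word λ w → IsFactor w u × P w × K ≤ length w
long-factor many K with many (wordsShorterThan K)
... | w , occ , Pw , w∉ with length w <? K
...   | yes short = ⊥-elim (w∉ (∈-wordsShorterThan K w short))
...   | no  long  = w , occ , Pw , ≮⇒≥ long

shift : ℕ → InfWord → InfWord
shift n z m = z (n + m)

Periodic : InfWord → ℕ → Set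
Periodic z P = ∀ m → z (m + P) ≡ z m

Antiperiodic : InfWord → ℕ → Set
Antiperiodic z D = ∀ m → z (m + D) ≡ not (z m)

periodic-multiple : ∀ {z P} → Periodic z P → ∀ k m → z (m + k * P) ≡ z m
periodic-multiple {z}     per zero    m = cong z (+-identityʳ m)
periodic-multiple {z} {P} per (suc k) m = begin
  z (m + (P + k * P))   ≡⟨ cong z (trans (cong (m +_) (+-comm P (k * P))) (sym (+-assoc m (k * P) P))) ⟩
  z (m + k * P + P)     ≡⟨ per (m + k * P) ⟩
  z (m + k * P)         ≡⟨ periodic-multiple per k m ⟩
  z m                   ∎
  where open ≡-Reasoning

periodic-mod : ∀ {z P′} → Periodic z (suc P′) → ∀ t → z t ≡ z (t % suc P′)
periodic-mod {z} {P′} per t = trans (cong z (m≡m%n+[m/n]*n t (suc P′)))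
                                     (periodic-multiple per (t / suc P′) (t % suc P′))

antiperiodic⇒periodic : ∀ {z D} → Antiperiodic z D → Periodic z (D + D)
antiperiodic⇒periodic {z} {D} anti m = begin
  z (m + (D + D))   ≡⟨ cong z (sym (+-assoc m D D)) ⟩
  z (m + D + D)     ≡⟨ anti (m + D) ⟩
  not (z (m + D))   ≡⟨ cong not (anti m) ⟩
  not (not (z m))   ≡⟨ not-involutive (z m) ⟩
  z m               ∎
  where open ≡-Reasoning

shift-antiperiodic : ∀ {z D} q → Antiperiodic z D → Antiperiodic (shift q z) D
shift-antiperiodic {z} {D} q anti m = trans (cong z (sym (+-assoc q m D))) (anti (q + m))

no-antiperiod-zero : ∀ {z} → ¬ Antiperiodic z 0
no-antiperiod-zero anti = not-¬ refl (anti 0)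

periodicWord-prefix : ∀ v a w n → n < length v → periodicWord v (a ∷ w) n ≡ at v n
periodicWord-prefix v a w n n<|v| with n <ᵇ length v in eq
... | true  = refl
... | false = ⊥-elim (subst T eq (<⇒<ᵇ n<|v|))

periodicWord-tail : ∀ v a w t
                  → periodicWord v (a ∷ w) (length v + t) ≡ at (a ∷ w) (t % suc (length w))
periodicWord-tail v a w t with length v + t <ᵇ length v in eq
... | true  = ⊥-elim (<⇒≱ (<ᵇ⇒< _ _ (subst T (sym eq) _)) (m≤m+n (length v) t))
... | false = cong (λ s → at (a ∷ w) (s % suc (length w))) (m+n∸m≡n (length v) t)

tail-periodic : ∀ {u} v a w → (∀ n → u n ≡ periodicWord v (a ∷ w) n)
              → Periodic (shift (length v) u) (suc (length w))
tail-periodic {u} v a w u≡ m = begin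
  u (length v + (m + p))         ≡⟨ tail-letter (m + p) ⟩
  at (a ∷ w) ((m + p) % p)       ≡⟨ cong (at (a ∷ w)) ([m+n]%n≡m%n m p) ⟩
  at (a ∷ w) (m % p)             ≡⟨ sym (tail-letter m) ⟩
  u (length v + m)               ∎
  where
  open ≡-Reasoning
  p = suc (length w)
  tail-letter : ∀ t → u (length v + t) ≡ at (a ∷ w) (t % p)
  tail-letter t = trans (u≡ (length v + t)) (periodicWord-tail v a w t)

tail-periodic⇒eqPeriodic : ∀ (u : InfWord) n (z : InfWord) {P′}
                         → (∀ t → u (n + t) ≡ z t) → Periodic z (suc P′)
                         → EqPeriodic u (factorAt u 0 n) (factorAt z 0 (suc P′))
tail-periodic⇒eqPeriodic u n z {P′} u≡z per = (λ ()) , letter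
  where
  b = factorAt u 0 n
  w = factorAt z 1 P′
  P = suc P′
  open ≡-Reasoning
  tail : ∀ t → u (n + t) ≡ periodicWord b (z 0 ∷ w) (n + t)
  tail t = sym (begin
    periodicWord b (z 0 ∷ w) (n + t)              ≡⟨ cong (λ k → periodicWord b (z 0 ∷ w) (k + t)) (sym (length-factor u 0 n)) ⟩
    periodicWord b (z 0 ∷ w) (length b + t)       ≡⟨ periodicWord-tail b (z 0) w t ⟩
    at (z 0 ∷ w) (t % suc (length w))             ≡⟨ cong (λ k → at (z 0 ∷ w) (t % suc k)) (length-factor z 1 P′) ⟩
    at (factorAt z 0 P) (t % P)                   ≡⟨ at-factor z 0 (t % P) (m%n<n t P) ⟩
    z (t % P)                                     ≡⟨ sym (periodic-mod per t) ⟩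
    z t                                           ≡⟨ sym (u≡z t) ⟩
    u (n + t)                                     ∎)
  letter : ∀ m → u m ≡ periodicWord b (z 0 ∷ w) m
  letter m with m <? n
  ... | yes m<n = sym (trans (periodicWord-prefix b (z 0) w m (subst (m <_) (sym (length-factor u 0 n)) m<n))
                             (at-factor u 0 m m<n))
  ... | no  m≮n = subst (λ k → u k ≡ periodicWord b (z 0 ∷ w) k) (m+[n∸m]≡n (≮⇒≥ m≮n)) (tail (m ∸ n))

module Residues (p′ : ℕ) where

  p : ℕ
  p = suc p′

  infix 4 _≈_
  record _≈_ (a b : ℕ) : Set where
    constructor same-residue
    field residue : a % p ≡ b % p

  ≈-refl : ∀ {a} → a ≈ a
  ≈-refl = same-residue refl

  ≈-sym : ∀ {a b} → a ≈ b → b ≈ a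
  ≈-sym (same-residue a≡b) = same-residue (sym a≡b)

  ≈-trans : ∀ {a b c} → a ≈ b → b ≈ c → a ≈ c
  ≈-trans (same-residue a≡b) (same-residue b≡c) = same-residue (trans a≡b b≡c)

  ≡⇒≈ : ∀ {a b} → a ≡ b → a ≈ b
  ≡⇒≈ refl = ≈-refl

  +-multiple : ∀ a k → a + k * p ≈ a
  +-multiple a k = same-residue ([m+kn]%n≡m%n a k p)

  +-≈ : ∀ {a b c d} → a ≈ b → c ≈ d → a + c ≈ b + d
  +-≈ {a} {b} {c} {d} (same-residue a≡b) (same-residue c≡d) = same-residue (begin
    (a + c) % p            ≡⟨ %-distribˡ-+ a c p ⟩
    (a % p + c % p) % p    ≡⟨ cong₂ (λ s t → (s + t) % p) a≡b c≡d ⟩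
    (b % p + d % p) % p    ≡⟨ sym (%-distribˡ-+ b d p) ⟩
    (b + d) % p            ∎)
    where open ≡-Reasoning

  -- a + (b + p′·a) = b + a·p: adding p′·a undoes adding a modulo p.
  private
    complement : ∀ a b q → a + (b + q * a) ≡ b + a * suc q
    complement = solve-∀

  cancel : ∀ a b → a + (b + p′ * a) ≈ b
  cancel a b = ≈-trans (≡⇒≈ (complement a b p′)) (+-multiple b a)

  ≈-cancelˡ : ∀ a {b c} → a + b ≈ a + c → b ≈ c
  ≈-cancelˡ a {b} {c} a+b≈a+c = ≈-trans (≈-sym (cancel a b)) (≈-trans sums (cancel a c))
    where
    sums : a + (b + p′ * a) ≈ a + (c + p′ * a)
    sums = ≈-trans (≡⇒≈ (sym (+-assoc a b (p′ * a))))
             (≈-trans (+-≈ a+b≈a+c ≈-refl) (≡⇒≈ (+-assoc a c (p′ * a))))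

  reach : ∀ a c → ∃ λ k → k < p × a + k ≈ c
  reach a c = (c + p′ * a) % p , m%n<n (c + p′ * a) p ,
              ≈-trans (+-≈ (≈-refl {a}) (same-residue (m%n%n≡m%n (c + p′ * a) p))) (cancel a c)

  periodic-≈ : ∀ {z} → Periodic z p → ∀ {a b} → a ≈ b → z a ≡ z b
  periodic-≈ {z} per {a} {b} (same-residue a≡b) =
    trans (periodic-mod per a) (trans (cong z a≡b) (sym (periodic-mod per b)))

module Reflections (u : InfWord) (N p′ : ℕ) (periodic : Periodic (shift N u) (suc p′)) where
  open Residues p′

  y : InfWord
  y = shift N u

  Reflection : (Bool → Bool) → ℕ → Set
  Reflection f S = ∀ a b → a + b ≈ S → y a ≡ f (y b)

  -- Mirroring one full period [i, i + p) onto [j, j + p) is already a reflection: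
  -- every a is congruent to some i + k, and then b is congruent to its mirror j + r.
  period-reflection : ∀ f i j → (∀ k r → suc (k + r) ≡ p → y (i + k) ≡ f (y (j + r)))
                    → Reflection f (i + j + p′)
  period-reflection f i j local a b a+b≈S with reach i a
  ... | k , k<p , i+k≈a = begin
    y a             ≡⟨ periodic-≈ periodic (≈-sym i+k≈a) ⟩
    y (i + k)       ≡⟨ local k r k+r ⟩
    f (y (j + r))   ≡⟨ cong f (periodic-≈ periodic (≈-sym b≈j+r)) ⟩
    f (y b)         ∎
    where
    open ≡-Reasoning
    r = p′ ∸ k
    k+r : suc (k + r) ≡ p
    k+r = cong suc (m+[n∸m]≡n (s≤s⁻¹ k<p))
    regroup : ∀ i k j r → i + k + (j + r) ≡ i + j + (k + r)
    regroup = solve-∀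
    b≈j+r : b ≈ j + r
    b≈j+r = ≈-cancelˡ (i + k) (≈-trans (+-≈ i+k≈a ≈-refl) (≈-trans a+b≈S (≡⇒≈ sums)))
      where
      sums : i + j + p′ ≡ i + k + (j + r)
      sums = begin
        i + j + p′          ≡⟨ cong (i + j +_) (sym (suc-injective k+r)) ⟩
        i + j + (k + r)     ≡⟨ sym (regroup i k j r) ⟩
        i + k + (j + r)     ∎

  -- An occurrence at i of an f-symmetric word of length N + N + p + e mirrors
  -- the period of y starting at i onto the one starting at i + e (in u these
  -- are the letters N, …, N + p - 1 of the word and their mirror letters).
  window-reflection : ∀ {w} f i → factorAt u i (length w) ≡ w → Symmetric f w
                    → N + N + p ≤ length w → ∃ λ S → Reflection f S
  window-reflection {w} f i occ sym-w long = i + (i + e) + p′ , period-reflection f i (i + e) local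
    where
    open ≡-Reasoning
    e = length w ∸ (N + N + p)
    inner : ∀ N i k → N + (i + k) ≡ i + (N + k)
    inner = solve-∀
    outer : ∀ N i e r → i + (N + e + r) ≡ N + (i + e + r)
    outer = solve-∀
    span : ∀ N k e r → suc (N + k + (N + e + r)) ≡ N + N + suc (k + r) + e
    span = solve-∀
    mirror : ∀ k r → suc (k + r) ≡ p → suc (N + k + (N + e + r)) ≡ length w
    mirror k r k+r = begin
      suc (N + k + (N + e + r))   ≡⟨ span N k e r ⟩
      N + N + suc (k + r) + e     ≡⟨ cong (λ s → N + N + s + e) k+r ⟩
      N + N + p + e               ≡⟨ m+[n∸m]≡n long ⟩
      length w                    ∎
    local : ∀ k r → suc (k + r) ≡ p → y (i + k) ≡ f (y (i + e + r))
    local k r k+r = begin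
      u (N + (i + k))             ≡⟨ cong u (inner N i k) ⟩
      u (i + (N + k))             ≡⟨ symmetric-occurrence f u i occ sym-w (N + k) (N + e + r) (mirror k r k+r) ⟩
      f (u (i + (N + e + r)))     ≡⟨ cong (λ s → f (u s)) (outer N i e r) ⟩
      f (u (N + (i + e + r)))     ∎

  reflection-from-factors : ∀ {Q} f → (∀ {w} → Q w → Symmetric f w)
                          → InfinitelyManyFactors Q u → ∃ λ S → Reflection f S
  reflection-from-factors f symmetric many with long-factor many (N + N + p)
  ... | w , (i , occ) , Qw , long = window-reflection f i occ (symmetric Qw) long

  -- A reflection followed by an antireflection is a translation that negates:
  -- if S + d ≡ T then m reflects to some b and b antireflects to m + d, so
  -- y(m + d) = not y(m).
  reflections-compose : ∀ {S T d} → Reflection id S → Reflection not T → S + d ≈ T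
                      → Antiperiodic y d
  reflections-compose {S} {T} {d} mirror antimirror S+d≈T m with reach m S
  ... | b , _ , m+b≈S = begin
    y (m + d)               ≡⟨ sym (not-involutive (y (m + d))) ⟩
    not (not (y (m + d)))   ≡⟨ cong not (sym (antimirror b (m + d) b+m+d≈T)) ⟩
    not (y b)               ≡⟨ cong not (sym (mirror m b m+b≈S)) ⟩
    not (y m)               ∎
    where
    open ≡-Reasoning
    regroup : ∀ b m d → b + (m + d) ≡ m + b + d
    regroup = solve-∀
    b+m+d≈T : b + (m + d) ≈ T
    b+m+d≈T = ≈-trans (≡⇒≈ (regroup b m d)) (≈-trans (+-≈ m+b≈S ≈-refl) S+d≈T)

  antiperiod : ∀ S T → Reflection id S → Reflection not T → ∃ λ d → Antiperiodic y (suc d)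
  antiperiod S T mirror antimirror with reach S T
  ... | zero  , _ , S≈T = ⊥-elim (no-antiperiod-zero (reflections-compose {S} {T} mirror antimirror S≈T))
  ... | suc d , _ , S≈T = d , reflections-compose {S} {T} mirror antimirror S≈T

  -- Given also a period P, a reflection mod p holds for the exact sum S + P
  -- (shift b by p′·P to make the sum S + P·p).
  exact-reflection : ∀ f S P → Reflection f S → Periodic y P
                   → ∀ a b → a + b ≡ S + P → y a ≡ f (y b)
  exact-reflection f S P reflection per a b a+b = begin
    y a                   ≡⟨ reflection a (b + p′ * P) sum≈S ⟩
    f (y (b + p′ * P))    ≡⟨ cong f (periodic-multiple per p′ b) ⟩
    f (y b)               ∎
    where
    open ≡-Reasoning
    regroup : ∀ S P q → S + P + q * P ≡ S + P * suc q
    regroup = solve-∀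
    sum≈S : a + (b + p′ * P) ≈ S
    sum≈S = ≈-trans (≡⇒≈ sum) (+-multiple S P)
      where
      sum : a + (b + p′ * P) ≡ S + P * p
      sum = begin
        a + (b + p′ * P)    ≡⟨ sym (+-assoc a b (p′ * P)) ⟩
        a + b + p′ * P      ≡⟨ cong (_+ p′ * P) a+b ⟩
        S + P + p′ * P      ≡⟨ regroup S P p′ ⟩
        S + P * p           ∎

parity : ∀ n → (∃ λ h → n ≡ h + h) ⊎ (∃ λ h → n ≡ suc (h + h))
parity zero = inj₁ (0 , refl)
parity (suc n) with parity n
... | inj₁ (h , n≡) = inj₂ (h , cong suc n≡)
... | inj₂ (h , n≡) = inj₁ (suc h , cong suc (trans n≡ (sym (+-suc h h))))

-- If s + D = 2h, the symmetry would make
-- y(h) = y(h + D) = not y(h); so s + D = 2h + 1, and the block starting at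
-- h + 1 is mirrored onto itself.
palindromic-block : ∀ (y : InfWord) D s → Antiperiodic y D
                  → (∀ a b → a + b ≡ s + (D + D) → y a ≡ y b)
                  → ∃ λ q → ∀ j r → suc (j + r) ≡ D → y (q + j) ≡ y (q + r)
palindromic-block y D s anti mirror with parity (s + D)
... | inj₁ (h , even) = ⊥-elim (not-¬ refl (trans (mirror h (h + D) centre) (anti h)))
  where
  open ≡-Reasoning
  centre : h + (h + D) ≡ s + (D + D)
  centre = begin
    h + (h + D)   ≡⟨ sym (+-assoc h h D) ⟩
    h + h + D     ≡⟨ cong (_+ D) (sym even) ⟩
    s + D + D     ≡⟨ +-assoc s D D ⟩
    s + (D + D)   ∎
... | inj₂ (h , odd) = suc h , λ j r j+r → mirror (suc h + j) (suc h + r) (centre j r j+r)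
  where
  open ≡-Reasoning
  regroup : ∀ h j r → suc h + j + (suc h + r) ≡ suc (h + h) + suc (j + r)
  regroup = solve-∀
  centre : ∀ j r → suc (j + r) ≡ D → suc h + j + (suc h + r) ≡ s + (D + D)
  centre j r j+r = begin
    suc h + j + (suc h + r)       ≡⟨ regroup h j r ⟩
    suc (h + h) + suc (j + r)     ≡⟨ cong₂ _+_ (sym odd) j+r ⟩
    s + D + D                     ≡⟨ +-assoc s D D ⟩
    s + (D + D)                   ∎

module Block (z : InfWord) (D : ℕ) (anti : Antiperiodic z D)
             (pal : ∀ j r → suc (j + r) ≡ D → z j ≡ z r) where

  c : Word
  c = factorAt z 0 D

  |c| : length c ≡ D
  |c| = length-factor z 0 D

  c-palindrome : IsPalindrome c
  c-palindrome = factor-ext z 0 (reverse c) (trans (length-reverse c) |c|) letter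
    where
    letter : ∀ x → x < D → at (reverse c) x ≡ z x
    letter x x<D with mirror-exists x<D
    ... | r , x+r = begin
      at (reverse c) x  ≡⟨ at-reverse c x r (trans x+r (sym |c|)) ⟩
      at c r            ≡⟨ at-factor z 0 r (mirror<ʳ x+r) ⟩
      z r               ≡⟨ sym (pal x r x+r) ⟩
      z x               ∎
      where open ≡-Reasoning

  E-block : E c ≡ factorAt z D D
  E-block = factor-ext z D (E c) (trans (length-reverse (map not c)) (trans (length-map not c) |c|)) letter
    where
    letter : ∀ x → x < D → at (E c) x ≡ z (D + x)
    letter x x<D with mirror-exists x<D
    ... | r , x+r = begin
      at (E c) x    ≡⟨ at-E c x r (trans x+r (sym |c|)) ⟩
      not (at c r)  ≡⟨ cong not (at-factor z 0 r (mirror<ʳ x+r)) ⟩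
      not (z r)     ≡⟨ cong not (sym (pal x r x+r)) ⟩
      not (z x)     ≡⟨ sym (anti x) ⟩
      z (x + D)     ≡⟨ cong z (+-comm x D) ⟩
      z (D + x)     ∎
      where open ≡-Reasoning

  square-block : factorAt z 0 (D + D) ≡ c ++ E c
  square-block = trans (factorAt-++ z 0 D D) (cong (c ++_) (sym E-block))

square-tail : ∀ (u : InfWord) n (z : InfWord) d → (∀ t → u (n + t) ≡ z t)
            → Antiperiodic z (suc d) → (∀ j r → suc (j + r) ≡ suc d → z j ≡ z r)
            → Σ Word λ b → Σ Word λ c → IsPalindrome c × EqPeriodic u b (c ++ E c)
square-tail u n z d u≡z anti pal =
  factorAt u 0 n , c , c-palindrome ,
  subst (EqPeriodic u (factorAt u 0 n)) square-block
        (tail-periodic⇒eqPeriodic u n z u≡z (antiperiodic⇒periodic anti))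
  where open Block z (suc d) anti pal

proposition27 : (u : InfWord) → EventuallyPeriodic u
    → InfinitelyManyFactors IsPalindrome u
    → InfinitelyManyFactors IsAntipalindrome u
    → Σ Word λ b → Σ Word λ c → IsPalindrome c × EqPeriodic u b (c ++ E c)
proposition27 u (v , [] , w≢[] , _) _ _ = ⊥-elim (w≢[] refl)
proposition27 u (v , a ∷ w , _ , u≡vw∞) palindromes antipalindromes =
  from-reflections (reflection-from-factors id palindrome-symmetric palindromes)
                   (reflection-from-factors not antipalindrome-symmetric antipalindromes)
  where
  open Reflections u (length v) (length w) (tail-periodic v a w u≡vw∞)
  from-reflections : ∃ (Reflection id) → ∃ (Reflection not)
                   → Σ Word λ b → Σ Word λ c → IsPalindrome c × EqPeriodic u b (c ++ E c)
  from-reflections (S , mirror) (T , antimirror) with antiperiod S T mirror antimirror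
  ... | d , anti with palindromic-block y (suc d) S anti
                        (exact-reflection id S (suc d + suc d) mirror (antiperiodic⇒periodic anti))
  ... | q , pal = square-tail u (length v + q) (shift q y) d (λ t → cong u (+-assoc (length v) q t))
                              (shift-antiperiodic q anti) pal
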